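{- Let $k\geq 0$ be an integer. The non-negative integer solutions $(x,y,z)$ of the Diophantine equation $-2^x+(2^k\cdot 5)^y=z^2$ are exactly: $(x,y,z)=(0,0,0)$ (for any $k\geq 0$), and, for each positive integer $n$, $(k,x,y,z)=(n-1,\,2n+2,\,2,\,3\cdot 2^{n-1})$, $(2n-1,\,2n-2,\,1,\,3\cdot 2^{n-1})$, $(2n-2,\,2n-2,\,1,\,2^n)$, $(2n-2,\,2n,\,1,\,2^{n-1})$, and $(2n-2,\,6n-4,\,3,\,11\cdot 8^{n-1})$.
   Context: Here $n$ ranges over the positive integers $\mathbb{N}=\{1,2,3,\dots\}$. -}

module Defs where

open import Data.Nat using (ℕ; _+_; _*_; _∸_; _^_; _≤_)
open import Data.Integer using (ℤ; +_; -_) renaming (_+_ to _+ℤ_)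
open import Data.Product using (_×_; ∃-syntax)
open import Data.Sum using (_⊎_)
open import Relation.Binary.PropositionalEquality using (_≡_)

Equation : ℕ → ℕ → ℕ → ℕ → Set
Equation k x y z = - (+ (2 ^ x)) +ℤ (+ ((2 ^ k * 5) ^ y)) ≡ + (z ^ 2)

Family : ℕ → ℕ → ℕ → ℕ → ℕ → Set
Family n k x y z =
    (k ≡ n ∸ 1 × x ≡ 2 * n + 2 × y ≡ 2 × z ≡ 3 * 2 ^ (n ∸ 1))
  ⊎ (k ≡ 2 * n ∸ 1 × x ≡ 2 * n ∸ 2 × y ≡ 1 × z ≡ 3 * 2 ^ (n ∸ 1))
  ⊎ (k ≡ 2 * n ∸ 2 × x ≡ 2 * n ∸ 2 × y ≡ 1 × z ≡ 2 ^ n)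
  ⊎ (k ≡ 2 * n ∸ 2 × x ≡ 2 * n × y ≡ 1 × z ≡ 2 ^ (n ∸ 1))
  ⊎ (k ≡ 2 * n ∸ 2 × x ≡ 6 * n ∸ 4 × y ≡ 3 × z ≡ 11 * 8 ^ (n ∸ 1))

Listed : ℕ → ℕ → ℕ → ℕ → Set
Listed k x y z =
    (x ≡ 0 × y ≡ 0 × z ≡ 0)
  ⊎ (∃[ n ] (1 ≤ n × Family n k x y z))

-- Write the equation as 2^x + z² = 2^(ky) · 5^y; for y = 0 only x = z = 0 is possible. For y > 0,
-- cancelling the common factor 4^j (5^y is odd, and 5 never divides 2 + z²) leaves one of
-- 1 + u² = 5^y, 1 + u² = 2 · 5^y with y odd, and 2^(m+2) + u² = 5^y. For even y these are settled
-- by factoring 5^y − u²; for odd y they become (2u)² + 4 = 5 (2 · 5^t)², u² + 1 = 10 (5^t)² and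
-- u² + 4 = 5 (5^t)², or are impossible modulo 8.
-- Every solution of w² − (1 + a²) v² = ±c arises from one with v² < c by repeated multiplication
-- by the unit a + √(1 + a²). So modulo 3775 (for a = 2, c = 4) and 775 (for a = 3, c = 1) the
-- solutions lie in finitely many computable orbits, which miss the residues of those v that are
-- the relevant multiples of powers of 5.

module Submission where

open import Defs
open import Data.Nat.Base
open import Data.Nat.Properties
open import Data.Nat.DivMod
open import Data.Nat.Divisibility using (_∣_; n∣m⇒m%n≡0; ∣n⇒∣m*n; m∣m*n)
open import Data.Nat.Induction using (<-rec)
open import Data.Nat.Tactic.RingSolver using (solve-∀; solve)
open import Function.Bundles using (_⇔_; mk⇔)
open import Function.Properties.Equivalence using () renaming (trans to ⇔-trans; sym to ⇔-sym)
import Data.Integer.Base as ℤ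
import Data.Integer.Properties as ℤ
open import Data.Product.Base using (_×_; _,_; proj₁; proj₂; ∃; ∃₂)
open import Data.Product.Properties using (≡-dec)
open import Data.Sum.Base using (_⊎_; inj₁; inj₂)
open import Data.List.Base using (List; []; _∷_; _++_; iterate; concatMap)
open import Data.List.Relation.Unary.All as All using (All; all?)
open import Data.List.Membership.Propositional using (_∈_; _∉_)
open import Data.List.Membership.DecPropositional _≟_ using () renaming (_∈?_ to _∈ℕ?_)
open import Data.List.Membership.DecPropositional (≡-dec _≟_ _≟_) using () renaming (_∈?_ to _∈ℕ²?_)
open import Function.Base using (_∘_)
open import Relation.Nullary using (¬_; ¬?; contradiction; yes; no)
open import Relation.Nullary.Decidable using (from-yes; from-no)
open import Relation.Binary.PropositionalEquality
open ≤-Reasoning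
open import Algebra.Properties.CommutativeSemigroup +-commutativeSemigroup using (xy∙z≈x∙zy; x∙yz≈xz∙y)
open import Algebra.Properties.CommutativeSemigroup *-commutativeSemigroup using () renaming (interchange to *-interchange)

data Parity : ℕ → Set where
  even : ∀ h → Parity (2 * h)
  odd  : ∀ h → Parity (1 + 2 * h)

parity? : ∀ n → Parity n
parity? zero = even 0
parity? (suc n) with parity? n
... | even h = odd h
... | odd h  = subst Parity (*-suc 2 h) (even (suc h))

m*m≤n*n⇒m≤n : ∀ m n → m * m ≤ n * n → m ≤ n
m*m≤n*n⇒m≤n m n le = ≮⇒≥ λ n<m → <⇒≱ (*-mono-< n<m n<m) le

m*m<n*n⇒m<n : ∀ m n → m * m < n * n → m < n
m*m<n*n⇒m<n m n lt = ≰⇒> λ n≤m → <⇒≱ lt (*-mono-≤ n≤m n≤m)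

m*m≡n*n⇒m≡n : ∀ m n → m * m ≡ n * n → m ≡ n
m*m≡n*n⇒m≡n m n eq =
  ≤-antisym (m*m≤n*n⇒m≤n m n (≤-reflexive eq)) (m*m≤n*n⇒m≤n n m (≤-reflexive (sym eq)))

[m*n]*[m*n]≡m*m*[n*n] : ∀ m n → (m * n) * (m * n) ≡ m * m * (n * n)
[m*n]*[m*n]≡m*m*[n*n] = solve-∀

m^[2n]≡m^n*m^n : ∀ m n → m ^ (2 * n) ≡ m ^ n * m ^ n
m^[2n]≡m^n*m^n m n = trans (cong (λ k → m ^ (n + k)) (+-identityʳ n)) (^-distribˡ-+-* m n n)

[m*n]^o≡m^o*n^o : ∀ m n o → (m * n) ^ o ≡ m ^ o * n ^ o
[m*n]^o≡m^o*n^o m n zero    = refl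
[m*n]^o≡m^o*n^o m n (suc o) = begin-equality
  m * n * (m * n) ^ o          ≡⟨ cong (m * n *_) ([m*n]^o≡m^o*n^o m n o) ⟩
  m * n * (m ^ o * n ^ o)      ≡⟨ *-interchange m n (m ^ o) (n ^ o) ⟩
  m * m ^ o * (n * n ^ o)      ∎

odd*n≡2^m⇒odd≡1 : ∀ h n m → (1 + 2 * h) * n ≡ 2 ^ m → h ≡ 0
odd*n≡2^m⇒odd≡1 h n zero eq = m+n≡0⇒m≡0 h (suc-injective (m*n≡1⇒m≡1 _ n eq))
odd*n≡2^m⇒odd≡1 h n (suc m) eq with parity? n
... | even g = odd*n≡2^m⇒odd≡1 h g m (*-cancelˡ-≡ _ _ 2 (begin-equality
      2 * ((1 + 2 * h) * g)  ≡⟨ solve (h ∷ g ∷ []) ⟩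
      (1 + 2 * h) * (2 * g)  ≡⟨ eq ⟩
      2 * 2 ^ m              ∎))
... | odd g = contradiction (begin-equality
      2 * 2 ^ m                          ≡⟨ eq ⟨
      (1 + 2 * h) * (1 + 2 * g)          ≡⟨ solve (h ∷ g ∷ []) ⟩
      1 + 2 * (h + g + 2 * h * g)        ∎) (even≢odd (2 ^ m) (h + g + 2 * h * g))

5^n-odd : ∀ n → ∃ λ k → 5 ^ n ≡ 1 + 2 * k
5^n-odd zero    = 0 , refl
5^n-odd (suc n) with 5^n-odd n
... | k , eq = 2 + 5 * k , (begin-equality
  5 * 5 ^ n            ≡⟨ cong (5 *_) eq ⟩
  5 * (1 + 2 * k)      ≡⟨ solve (k ∷ []) ⟩
  1 + 2 * (2 + 5 * k)  ∎)

1+m*m≡n*n⇒m≡0 : ∀ m n → 1 + m * m ≡ n * n → m ≡ 0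
1+m*m≡n*n⇒m≡0 m n eq = m+n≡0⇒m≡0 m (n≤0⇒n≡0 (+-cancelˡ-≤ (1 + m * m) (2 * m) 0 (begin
  1 + m * m + 2 * m     ≡⟨ solve (m ∷ []) ⟩
  suc m * suc m         ≤⟨ *-mono-≤ m<n m<n ⟩
  n * n                 ≡⟨ eq ⟨
  1 + m * m             ≡⟨ +-identityʳ (1 + m * m) ⟨
  1 + m * m + 0         ∎)))
  where
  m<n : m < n
  m<n = m*m<n*n⇒m<n m n (≤-reflexive eq)

square-expand : ∀ m d → (m + d) * (m + d) ≡ m * m + d * (2 * m + d)
square-expand = solve-∀

m*m+k≡n*n⇒n≡m+d : ∀ m k n → m * m + k ≡ n * n → ∃ λ d → n ≡ m + d × d * (2 * m + d) ≡ k
m*m+k≡n*n⇒n≡m+d m k n eq = d , sym m+d≡n , +-cancelˡ-≡ (m * m) _ _ (begin-equality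
  m * m + d * (2 * m + d)   ≡⟨ square-expand m d ⟨
  (m + d) * (m + d)         ≡⟨ cong (λ x → x * x) m+d≡n ⟩
  n * n                     ≡⟨ eq ⟨
  m * m + k                 ∎)
  where
  d = n ∸ m
  m+d≡n : m + d ≡ n
  m+d≡n = m+[n∸m]≡n (m*m≤n*n⇒m≤n m n (≤-trans (m≤m+n (m * m) k) (≤-reflexive eq)))

%-cong-+ : ∀ {m m′ n n′} d .{{_ : NonZero d}} →
           m % d ≡ m′ % d → n % d ≡ n′ % d → (m + n) % d ≡ (m′ + n′) % d
%-cong-+ {m} {m′} {n} {n′} d m≡m′ n≡n′ = begin-equality
  (m + n) % d              ≡⟨ %-distribˡ-+ m n d ⟩
  (m % d + n % d) % d      ≡⟨ cong₂ (λ x y → (x + y) % d) m≡m′ n≡n′ ⟩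
  (m′ % d + n′ % d) % d    ≡⟨ %-distribˡ-+ m′ n′ d ⟨
  (m′ + n′) % d            ∎

%-cong-* : ∀ {m m′ n n′} d .{{_ : NonZero d}} →
           m % d ≡ m′ % d → n % d ≡ n′ % d → (m * n) % d ≡ (m′ * n′) % d
%-cong-* {m} {m′} {n} {n′} d m≡m′ n≡n′ = begin-equality
  (m * n) % d              ≡⟨ %-distribˡ-* m n d ⟩
  (m % d * (n % d)) % d    ≡⟨ cong₂ (λ x y → (x * y) % d) m≡m′ n≡n′ ⟩
  (m′ % d * (n′ % d)) % d  ≡⟨ %-distribˡ-* m′ n′ d ⟨
  (m′ * n′) % d            ∎

[m^n]%d≡1 : ∀ m n d .{{_ : NonZero d}} → m % d ≡ 1 % d → (m ^ n) % d ≡ 1 % d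
[m^n]%d≡1 m zero    d _   = refl
[m^n]%d≡1 m (suc n) d m≡1 = %-cong-* d m≡1 ([m^n]%d≡1 m n d m≡1)

5^[2t]%d≡1 : ∀ t d .{{_ : NonZero d}} → 25 % d ≡ 1 % d → 5 ^ (2 * t) % d ≡ 1 % d
5^[2t]%d≡1 t d 25≡1 = trans (cong (_% d) (sym (^-*-assoc 5 2 t))) ([m^n]%d≡1 25 t d 25≡1)

5^[1+2t]%8≡5 : ∀ t → 5 ^ (1 + 2 * t) % 8 ≡ 5
5^[1+2t]%8≡5 t = %-cong-* {5} {5} {5 ^ (2 * t)} {1} 8 refl (5^[2t]%d≡1 t 8 refl)

[1+2h]²%8≡1 : ∀ h → (1 + 2 * h) * (1 + 2 * h) % 8 ≡ 1
[1+2h]²%8≡1 h with parity? h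
... | even g = trans (cong (_% 8) square) ([m+kn]%n≡m%n 1 (g + 2 * g * g) 8)
  where
  square : (1 + 2 * (2 * g)) * (1 + 2 * (2 * g)) ≡ 1 + (g + 2 * g * g) * 8
  square = solve (g ∷ [])
... | odd g = trans (cong (_% 8) square) ([m+kn]%n≡m%n 1 (1 + 3 * g + 2 * g * g) 8)
  where
  square : (1 + 2 * (1 + 2 * g)) * (1 + 2 * (1 + 2 * g)) ≡ 1 + (1 + 3 * g + 2 * g * g) * 8
  square = solve (g ∷ [])

2^n%3≡1∨2 : ∀ n → 2 ^ n % 3 ≡ 1 ⊎ 2 ^ n % 3 ≡ 2
2^n%3≡1∨2 zero = inj₁ refl
2^n%3≡1∨2 (suc n) with 2^n%3≡1∨2 n
... | inj₁ r = inj₂ (%-cong-* {2} {2} {2 ^ n} {1} 3 refl r)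
... | inj₂ r = inj₁ (%-cong-* {2} {2} {2 ^ n} {2} 3 refl r)

2^[3+m]≡2^m*8 : ∀ m → 2 ^ (3 + m) ≡ 2 ^ m * 8
2^[3+m]≡2^m*8 m = trans (^-distribˡ-+-* 2 3 m) (*-comm 8 (2 ^ m))

5∤2+z² : ∀ z → ¬ 5 ∣ 2 + z * z
5∤2+z² z 5∣ = residues (z % 5) (m%n<n z 5) (begin-equality
  (2 + z % 5 * (z % 5)) % 5     ≡⟨ %-cong-+ {2} {2} {z % 5 * (z % 5)} {z * z} 5 refl
                                     (%-cong-* {z % 5} {z} {z % 5} {z} 5 (m%n%n≡m%n z 5) (m%n%n≡m%n z 5)) ⟩
  (2 + z * z) % 5               ≡⟨ n∣m⇒m%n≡0 _ 5 5∣ ⟩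
  0                             ∎)
  where
  residues : ∀ r → r < 5 → (2 + r * r) % 5 ≢ 0
  residues 0 _ ()
  residues 1 _ ()
  residues 2 _ ()
  residues 3 _ ()
  residues 4 _ ()
  residues (suc (suc (suc (suc (suc _))))) (s≤s (s≤s (s≤s (s≤s (s≤s ()))))) _

-- Pell equations w² − (1 + a²) v² = ±c

v<W+a*v : ∀ {a W v} → 2 ≤ a → 0 < W + a * v → v < W + a * v
v<W+a*v {v = zero}  _   0<W = 0<W
v<W+a*v {a} {W} {v@(suc _)} 2≤a _ = begin-strict
  v          <⟨ m<m*n v a 2≤a ⟩
  v * a      ≡⟨ *-comm v a ⟩
  a * v      ≤⟨ m≤n+m (a * v) W ⟩
  W + a * v  ∎

-- Multiplication by the unit a + √(1 + a²) of norm −1 flips the sign of the norm.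
norm-flip : ∀ a W V →
  (a * W + suc (a * a) * V) * (a * W + suc (a * a) * V) + W * W ≡
  suc (a * a) * ((W + a * V) * (W + a * V)) + suc (a * a) * (V * V)
norm-flip = solve-∀

unit-expand : ∀ a W V → a * (W + a * V) + V ≡ a * W + suc (a * a) * V
unit-expand = solve-∀

module PellDescent (a c : ℕ) where

  D : ℕ
  D = suc (a * a)

  Pell : ℕ → ℕ → Set
  Pell w v = w * w + c ≡ D * (v * v) ⊎ w * w ≡ D * (v * v) + c

  pell-unstep : ∀ {W V} → Pell (a * W + D * V) (W + a * V) → Pell W V
  pell-unstep {W} {V} (inj₁ eq) = inj₂ (+-cancelˡ-≡ (X * X) _ _ (begin-equality
      X * X + W * W                ≡⟨ norm-flip a W V ⟩
      D * (Y * Y) + D * (V * V)    ≡⟨ cong (_+ D * (V * V)) eq ⟨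
      X * X + c + D * (V * V)      ≡⟨ xy∙z≈x∙zy (X * X) c _ ⟩
      X * X + (D * (V * V) + c)    ∎))
    where X = a * W + D * V; Y = W + a * V
  pell-unstep {W} {V} (inj₂ eq) = inj₁ (+-cancelˡ-≡ (D * (Y * Y)) _ _ (begin-equality
      D * (Y * Y) + (W * W + c)    ≡⟨ x∙yz≈xz∙y (D * (Y * Y)) (W * W) c ⟩
      D * (Y * Y) + c + W * W      ≡⟨ cong (_+ W * W) eq ⟨
      X * X + W * W                ≡⟨ norm-flip a W V ⟩
      D * (Y * Y) + D * (V * V)    ∎))
    where X = a * W + D * V; Y = W + a * V

  a²v²≤w² : ∀ {w v} → c ≤ v * v → Pell w v → a * a * (v * v) ≤ w * w
  a²v²≤w² {w} {v} c≤v² (inj₁ eq) = +-cancelʳ-≤ c _ _ (begin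
    a * a * (v * v) + c          ≤⟨ +-monoʳ-≤ (a * a * (v * v)) c≤v² ⟩
    a * a * (v * v) + v * v      ≡⟨ +-comm (a * a * (v * v)) (v * v) ⟩
    D * (v * v)                  ≡⟨ eq ⟨
    w * w + c                    ∎)
  a²v²≤w² {w} {v} _ (inj₂ eq) = begin
    a * a * (v * v)              ≤⟨ m≤n+m _ (v * v) ⟩
    D * (v * v)                  ≤⟨ m≤m+n _ c ⟩
    D * (v * v) + c              ≡⟨ eq ⟨
    w * w                        ∎

  w²≤Dv²+c : ∀ {w v} → Pell w v → w * w ≤ D * (v * v) + c
  w²≤Dv²+c {w} {v} (inj₁ eq) = begin
    w * w                        ≤⟨ m≤m+n (w * w) c ⟩
    w * w + c                    ≡⟨ eq ⟩
    D * (v * v)                  ≤⟨ m≤m+n _ c ⟩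
    D * (v * v) + c              ∎
  w²≤Dv²+c (inj₂ eq) = ≤-reflexive eq

  -- Division by the unit: (w, v) ↦ (Dv − aw, w − av) stays in ℕ as long as c ≤ v².
  descend : ∀ {w v} → c ≤ v * v → Pell w v →
            ∃₂ λ W V → w ≡ a * W + D * V × v ≡ W + a * V
  descend {w} {v} c≤v² sol = W , V , w≡aW+DV , v≡W+aV
    where
    av≤w : a * v ≤ w
    av≤w = m*m≤n*n⇒m≤n (a * v) w (begin
      (a * v) * (a * v)              ≡⟨ [m*n]*[m*n]≡m*m*[n*n] a v ⟩
      a * a * (v * v)                ≤⟨ a²v²≤w² {w} {v} c≤v² sol ⟩
      w * w                          ∎)
    aw≤Dv : a * w ≤ D * v
    aw≤Dv = m*m≤n*n⇒m≤n (a * w) (D * v) (begin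
      (a * w) * (a * w)              ≡⟨ [m*n]*[m*n]≡m*m*[n*n] a w ⟩
      a * a * (w * w)                ≤⟨ *-monoʳ-≤ (a * a)
                                          (≤-trans (w²≤Dv²+c {w} {v} sol) (+-monoʳ-≤ (D * (v * v)) c≤v²)) ⟩
      a * a * (D * (v * v) + v * v)  ≡⟨ *-distribˡ-+ (a * a) (D * (v * v)) (v * v) ⟩
      a * a * (D * (v * v)) + a * a * (v * v) ≤⟨ +-monoʳ-≤ (a * a * (D * (v * v))) (m≤n+m (a * a * (v * v)) (v * v)) ⟩
      a * a * (D * (v * v)) + D * (v * v)     ≡⟨ +-comm _ (D * (v * v)) ⟩
      D * (D * (v * v))              ≡⟨ *-assoc D D (v * v) ⟨
      D * D * (v * v)                ≡⟨ [m*n]*[m*n]≡m*m*[n*n] D v ⟨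
      (D * v) * (D * v)              ∎)
    V = w ∸ a * v
    W = D * v ∸ a * w
    v≡W+aV : v ≡ W + a * V
    v≡W+aV = +-cancelˡ-≡ (a * (a * v)) _ _ (begin-equality
      a * (a * v) + v                ≡⟨ cong (_+ v) (*-assoc a a v) ⟨
      a * a * v + v                  ≡⟨ +-comm (a * a * v) v ⟩
      D * v                          ≡⟨ m+[n∸m]≡n aw≤Dv ⟨
      a * w + W                      ≡⟨ cong (λ t → a * t + W) (m+[n∸m]≡n av≤w) ⟨
      a * (a * v + V) + W            ≡⟨ cong (_+ W) (*-distribˡ-+ a (a * v) V) ⟩
      a * (a * v) + a * V + W        ≡⟨ xy∙z≈x∙zy (a * (a * v)) (a * V) W ⟩
      a * (a * v) + (W + a * V)      ∎)
    w≡aW+DV : w ≡ a * W + D * V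
    w≡aW+DV = begin-equality
      w                              ≡⟨ m+[n∸m]≡n av≤w ⟨
      a * v + V                      ≡⟨ cong (λ t → a * t + V) v≡W+aV ⟩
      a * (W + a * V) + V            ≡⟨ unit-expand a W V ⟩
      a * W + D * V                  ∎

  pell-induction : 2 ≤ a → 1 ≤ c → (P : ℕ → ℕ → Set) →
                   (∀ {W V} → P W V → P (a * W + D * V) (W + a * V)) →
                   (∀ {w v} → v * v < c → Pell w v → P w v) →
                   ∀ {w v} → Pell w v → P w v
  pell-induction 2≤a 1≤c P step base {w} {v} = <-rec (λ v → ∀ {w} → Pell w v → P w v) go v
    where
    go : ∀ v → (∀ {v′} → v′ < v → ∀ {w} → Pell w v′ → P w v′) → ∀ {w} → Pell w v → P w v
    go v rec {w} sol with v * v <? c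
    ... | yes v²<c = base v²<c sol
    ... | no v²≮c with descend {w} {v} (≮⇒≥ v²≮c) sol
    ...   | W , V , refl , refl =
      step (rec (v<W+a*v 2≤a (m*m<n*n⇒m<n 0 (W + a * V) (≤-trans 1≤c (≮⇒≥ v²≮c)))) (pell-unstep sol))

-- Residues of Pell solutions

ascent : ℕ → ℕ × ℕ → ℕ × ℕ
ascent a (W , V) = a * W + suc (a * a) * V , W + a * V

reduce : (M : ℕ) .{{_ : NonZero M}} → ℕ × ℕ → ℕ × ℕ
reduce M (w , v) = w % M , v % M

reduce-ascent : ∀ a M .{{_ : NonZero M}} (p : ℕ × ℕ) →
                reduce M (ascent a (reduce M p)) ≡ reduce M (ascent a p)
reduce-ascent a M (w , v) = cong₂ _,_
  (%-cong-+ M (%-cong-* {a} M refl (m%n%n≡m%n w M)) (%-cong-* {suc (a * a)} M refl (m%n%n≡m%n v M)))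
  (%-cong-+ M (m%n%n≡m%n w M) (%-cong-* {a} M refl (m%n%n≡m%n v M)))

residue-invariant : ∀ {A : Set} (ρ f : A → A) {R : List A} →
                    (∀ x → ρ (f (ρ x)) ≡ ρ (f x)) →
                    All (λ r → ρ (f r) ∈ R) R →
                    ∀ {x} → ρ x ∈ R → ρ (f x) ∈ R
residue-invariant ρ f compat closed {x} x∈R = subst (_∈ _) (compat x) (All.lookup closed x∈R)

m^t*n-invariant : ∀ (P : ℕ → Set) m → (∀ {x} → P x → P (m * x)) → ∀ {n} → P n → ∀ t → P (m ^ t * n)
m^t*n-invariant P m step {n} Pn zero    = subst P (sym (*-identityˡ n)) Pn
m^t*n-invariant P m step {n} Pn (suc t) =
  subst P (sym (*-assoc m (m ^ t) n)) (step (m^t*n-invariant P m step Pn t))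

pell-residues : ∀ a c M .{{_ : NonZero M}} {R : List (ℕ × ℕ)} → 2 ≤ a → 1 ≤ c →
                All (λ r → reduce M (ascent a r) ∈ R) R →
                (∀ {w v} → v * v < c → PellDescent.Pell a c w v → reduce M (w , v) ∈ R) →
                ∀ {w v} → PellDescent.Pell a c w v → reduce M (w , v) ∈ R
pell-residues a c M {R} 2≤a 1≤c closed base {w} {v} =
  PellDescent.pell-induction a c 2≤a 1≤c (λ w v → reduce M (w , v) ∈ R)
    (λ {W} {V} → residue-invariant (reduce M) (ascent a) {R} (reduce-ascent a M) closed {W , V})
    (λ {w} {v} → base {w} {v}) {w} {v}

m^t*n-residues : ∀ m M .{{_ : NonZero M}} {S : List ℕ} → All (λ r → (m * r) % M ∈ S) S →
                 ∀ {n} → n % M ∈ S → ∀ t → (m ^ t * n) % M ∈ S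
m^t*n-residues m M {S} closed = m^t*n-invariant (λ n → n % M ∈ S) m
  (λ {x} → residue-invariant (_% M) (m *_) {S} (λ x → %-cong-* {m} {m} {x % M} {x} M refl (m%n%n≡m%n x M)) closed {x})

v²<4⇒v≤1 : ∀ {v} → v * v < 4 → v ≡ 0 ⊎ v ≡ 1
v²<4⇒v≤1 {0} _ = inj₁ refl
v²<4⇒v≤1 {1} _ = inj₂ refl
v²<4⇒v≤1 {suc (suc v)} v²<4 =
  contradiction (*-mono-≤ {2} {suc (suc v)} {2} {suc (suc v)} (s≤s (s≤s z≤n)) (s≤s (s≤s z≤n))) (<⇒≱ v²<4)

module Lucas = PellDescent 2 4

-- The solutions of w² − 5v² = ±4 are the Lucas pairs (Lₙ, Fₙ). Modulo 3775 = 5² · 151 they form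
-- the three orbits below, and no Fₙ is congruent to 5^t · 25 or to 5^t · 10.
lucasResidues : List (ℕ × ℕ)
lucasResidues = concatMap (λ p → iterate (reduce 3775 ∘ ascent 2) p 100) ((2 , 0) ∷ (1 , 1) ∷ (3 , 1) ∷ [])

lucasExcluded : List ℕ
lucasExcluded = iterate (λ r → (5 * r) % 3775) 25 75 ++ iterate (λ r → (5 * r) % 3775) 10 76

lucas-excluded-closed : All (λ r → (5 * r) % 3775 ∈ lucasExcluded) lucasExcluded
lucas-excluded-closed = from-yes (all? (λ r → (5 * r) % 3775 ∈ℕ? lucasExcluded) lucasExcluded)

lucas-avoids : ∀ {w v} → v % 3775 ∈ lucasExcluded → ¬ Lucas.Pell w v
lucas-avoids {w} {v} v∈S sol =
  All.lookup disjoint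
    (pell-residues 2 4 3775 (s≤s (s≤s z≤n)) (s≤s z≤n) closed (λ {w} {v} → base {w} {v}) {w} {v} sol) v∈S
  where
  closed : All (λ r → reduce 3775 (ascent 2 r) ∈ lucasResidues) lucasResidues
  closed = from-yes (all? (λ r → reduce 3775 (ascent 2 r) ∈ℕ²? lucasResidues) lucasResidues)
  base : ∀ {w v} → v * v < 4 → Lucas.Pell w v → reduce 3775 (w , v) ∈ lucasResidues
  base {w} {v} v²<4 sol with v²<4⇒v≤1 {v} v²<4 | sol
  ... | inj₁ refl | inj₁ eq = contradiction (m+n≡0⇒n≡0 (w * w) eq) λ ()
  ... | inj₁ refl | inj₂ eq rewrite m*m≡n*n⇒m≡n w 2 eq = from-yes ((2 , 0) ∈ℕ²? lucasResidues)
  ... | inj₂ refl | inj₁ eq rewrite m*m≡n*n⇒m≡n w 1 (+-cancelʳ-≡ 4 (w * w) 1 eq) =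
    from-yes ((1 , 1) ∈ℕ²? lucasResidues)
  ... | inj₂ refl | inj₂ eq rewrite m*m≡n*n⇒m≡n w 3 eq = from-yes ((3 , 1) ∈ℕ²? lucasResidues)
  disjoint : All (λ r → proj₂ r ∉ lucasExcluded) lucasResidues
  disjoint = from-yes (all? (λ r → ¬? (proj₂ r ∈ℕ? lucasExcluded)) lucasResidues)

¬lucas-5^[2+t] : ∀ {w} t → ¬ Lucas.Pell w (5 ^ (2 + t))
¬lucas-5^[2+t] {w} t = lucas-avoids {w} {5 ^ (2 + t)} (subst (λ v → v % 3775 ∈ lucasExcluded) (5^t*25≡5^[2+t] t)
  (m^t*n-residues 5 3775 {lucasExcluded} lucas-excluded-closed (from-yes (25 ∈ℕ? lucasExcluded)) t))
  where
  5^t*25≡5^[2+t] : ∀ t → 5 ^ t * 25 ≡ 5 ^ (2 + t)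
  5^t*25≡5^[2+t] t = trans (*-comm (5 ^ t) 25) (*-assoc 5 5 (5 ^ t))

¬lucas-2*5^[1+t] : ∀ {w} t → ¬ Lucas.Pell w (2 * 5 ^ (1 + t))
¬lucas-2*5^[1+t] {w} t = lucas-avoids {w} {2 * 5 ^ (1 + t)} (subst (λ v → v % 3775 ∈ lucasExcluded) (5^t*10≡2*5^[1+t] t)
  (m^t*n-residues 5 3775 {lucasExcluded} lucas-excluded-closed (from-yes (10 ∈ℕ? lucasExcluded)) t))
  where
  5^t*10≡2*5^[1+t] : ∀ t → 5 ^ t * 10 ≡ 2 * 5 ^ (1 + t)
  5^t*10≡2*5^[1+t] t = trans (*-comm (5 ^ t) 10) (*-assoc 2 5 (5 ^ t))

module NegativePell10 = PellDescent 3 1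

-- Modulo 775 = 5² · 31 the solutions of w² − 10v² = ±1 form one orbit, avoiding every 5^t · 5.
pell10Residues : List (ℕ × ℕ)
pell10Residues = iterate (reduce 775 ∘ ascent 3) (1 , 0) 300

pell10Excluded : List ℕ
pell10Excluded = iterate (λ r → (5 * r) % 775) 5 4

pell10-avoids : ∀ {w v} → v % 775 ∈ pell10Excluded → ¬ NegativePell10.Pell w v
pell10-avoids {w} {v} v∈S sol =
  All.lookup disjoint
    (pell-residues 3 1 775 (s≤s (s≤s z≤n)) (s≤s z≤n) closed (λ {w} {v} → base {w} {v}) {w} {v} sol) v∈S
  where
  closed : All (λ r → reduce 775 (ascent 3 r) ∈ pell10Residues) pell10Residues
  closed = from-yes (all? (λ r → reduce 775 (ascent 3 r) ∈ℕ²? pell10Residues) pell10Residues)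
  base : ∀ {w v} → v * v < 1 → NegativePell10.Pell w v → reduce 775 (w , v) ∈ pell10Residues
  base {w} {0} _ (inj₁ eq) = contradiction (m+n≡0⇒n≡0 (w * w) eq) λ ()
  base {w} {0} _ (inj₂ eq) rewrite m*m≡n*n⇒m≡n w 1 eq = from-yes ((1 , 0) ∈ℕ²? pell10Residues)
  base {v = suc _} (s≤s ()) _
  disjoint : All (λ r → proj₂ r ∉ pell10Excluded) pell10Residues
  disjoint = from-yes (all? (λ r → ¬? (proj₂ r ∈ℕ? pell10Excluded)) pell10Residues)

¬pell10-5^[1+t] : ∀ {w} t → ¬ NegativePell10.Pell w (5 ^ (1 + t))
¬pell10-5^[1+t] {w} t = pell10-avoids {w} {5 ^ (1 + t)} (subst (λ v → v % 775 ∈ pell10Excluded) (*-comm (5 ^ t) 5)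
  (m^t*n-residues 5 775 {pell10Excluded} closed (from-yes (5 ∈ℕ? pell10Excluded)) t))
  where
  closed : All (λ r → (5 * r) % 775 ∈ pell10Excluded) pell10Excluded
  closed = from-yes (all? (λ r → (5 * r) % 775 ∈ℕ? pell10Excluded) pell10Excluded)

-- The reduced equations

1+u²≡5s²⇒lucas : ∀ {u s} → 1 + u * u ≡ 5 * (s * s) → Lucas.Pell (2 * u) (2 * s)
1+u²≡5s²⇒lucas {u} {s} eq = inj₁ (begin-equality
  (2 * u) * (2 * u) + 4    ≡⟨ solve (u ∷ []) ⟩
  4 * (1 + u * u)          ≡⟨ cong (4 *_) eq ⟩
  4 * (5 * (s * s))        ≡⟨ solve (s ∷ []) ⟩
  5 * ((2 * s) * (2 * s))  ∎)

1+u²≡5^y⇒y≡1∧u≡2 : ∀ {y u} → 1 ≤ y → 1 + u * u ≡ 5 ^ y → y ≡ 1 × u ≡ 2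
1+u²≡5^y⇒y≡1∧u≡2 {y} {u} 1≤y eq with parity? y
... | even h with 1+m*m≡n*n⇒m≡0 u (5 ^ h) (trans eq (m^[2n]≡m^n*m^n 5 h))
...   | refl with m^n≡1⇒n≡0∨m≡1 5 (2 * h) (sym eq)
...     | inj₁ 2h≡0 = contradiction (subst (1 ≤_) 2h≡0 1≤y) λ ()
...     | inj₂ ()
1+u²≡5^y⇒y≡1∧u≡2 {u = u} _ eq | odd zero    = refl , m*m≡n*n⇒m≡n u 2 (+-cancelˡ-≡ 1 (u * u) 4 eq)
1+u²≡5^y⇒y≡1∧u≡2 {u = u} _ eq | odd (suc t) =
  contradiction (1+u²≡5s²⇒lucas {u} {5 ^ suc t} (trans eq (cong (5 *_) (m^[2n]≡m^n*m^n 5 (suc t)))))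
                (¬lucas-2*5^[1+t] {2 * u} t)

1+u²≡2*5^[1+2h]⇒h≡0∧u≡3 : ∀ {h u} → 1 + u * u ≡ 2 * 5 ^ (1 + 2 * h) → h ≡ 0 × u ≡ 3
1+u²≡2*5^[1+2h]⇒h≡0∧u≡3 {zero}  {u} eq = refl , m*m≡n*n⇒m≡n u 3 (+-cancelˡ-≡ 1 (u * u) 9 eq)
1+u²≡2*5^[1+2h]⇒h≡0∧u≡3 {suc t} {u} eq = contradiction (inj₁ (begin-equality
  u * u + 1                        ≡⟨ +-comm (u * u) 1 ⟩
  1 + u * u                        ≡⟨ eq ⟩
  2 * (5 * 5 ^ (2 * suc t))        ≡⟨ *-assoc 2 5 (5 ^ (2 * suc t)) ⟨
  10 * 5 ^ (2 * suc t)             ≡⟨ cong (10 *_) (m^[2n]≡m^n*m^n 5 (suc t)) ⟩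
  10 * (5 ^ suc t * 5 ^ suc t)     ∎)) (¬pell10-5^[1+t] {u} t)

-- Modulo 8 the exponent t must be even; then 5^t ≡ 1 (mod 3) but 1 + 2^(3+m) ≢ 1 (mod 3).
5^t≡1+2^[1+m] : ∀ {t m} → 5 ^ t ≡ 1 + 2 ^ (1 + m) → m ≡ 1 × t ≡ 1
5^t≡1+2^[1+m] {zero}  {zero} ()
5^t≡1+2^[1+m] {suc t} {zero} eq = contradiction (subst (5 ≤_) eq (*-monoʳ-≤ 5 (m^n>0 5 t))) (from-no (5 ≤? 3))
5^t≡1+2^[1+m] {zero}  {suc zero} ()
5^t≡1+2^[1+m] {suc t} {suc zero} eq with m^n≡1⇒n≡0∨m≡1 5 t (*-cancelˡ-≡ (5 ^ t) 1 5 eq)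
... | inj₁ refl = refl , refl
5^t≡1+2^[1+m] {t} {suc (suc m)} eq with parity? t
... | odd s = contradiction (begin-equality
      5                                  ≡⟨ 5^[1+2t]%8≡5 s ⟨
      5 ^ (1 + 2 * s) % 8                ≡⟨ cong (_% 8) eq ⟩
      (1 + 2 ^ (3 + m)) % 8              ≡⟨ cong (λ n → (1 + n) % 8) (2^[3+m]≡2^m*8 m) ⟩
      (1 + 2 ^ m * 8) % 8                ≡⟨ [m+kn]%n≡m%n 1 (2 ^ m) 8 ⟩
      1                                  ∎) λ ()
... | even s = contradiction (begin-equality
      1                                  ≡⟨ 5^[2t]%d≡1 s 3 refl ⟨
      5 ^ (2 * s) % 3                    ≡⟨ cong (_% 3) eq ⟩
      (1 + 2 ^ (3 + m)) % 3              ≡⟨ %-cong-+ {1} {1} {2 ^ (3 + m) % 3} {2 ^ (3 + m)} 3 refl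
                                              (m%n%n≡m%n (2 ^ (3 + m)) 3) ⟨
      (1 + 2 ^ (3 + m) % 3) % 3          ∎) (1≢[1+r]%3 (2^n%3≡1∨2 (3 + m)))
  where
  1≢[1+r]%3 : ∀ {r} → r ≡ 1 ⊎ r ≡ 2 → 1 ≢ (1 + r) % 3
  1≢[1+r]%3 (inj₁ refl) ()
  1≢[1+r]%3 (inj₂ refl) ()

2p*[2u+2p]≡2^[2+n]⇒p*[u+p]≡2^n : ∀ u p n → 2 * p * (2 * u + 2 * p) ≡ 2 ^ (2 + n) → p * (u + p) ≡ 2 ^ n
2p*[2u+2p]≡2^[2+n]⇒p*[u+p]≡2^n u p n eq = *-cancelˡ-≡ _ _ 2 (*-cancelˡ-≡ _ _ 2 (begin-equality
  2 * (2 * (p * (u + p)))       ≡⟨ solve (u ∷ p ∷ []) ⟩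
  2 * p * (2 * u + 2 * p)       ≡⟨ eq ⟩
  2 * (2 * 2 ^ n)               ∎))

-- d and d + 2u are powers of 2, so d ≠ 1; as u is odd, one of d/2 and d/2 + u is odd, hence 1.
d*[2u+d]≡2^[2+n] : ∀ h d n → d * (2 * (1 + 2 * h) + d) ≡ 2 ^ (2 + n) → d ≡ 2 × 2 + 2 * h ≡ 2 ^ n
d*[2u+d]≡2^[2+n] h d n eq with parity? d
... | odd g with odd*n≡2^m⇒odd≡1 g (2 * (1 + 2 * h) + (1 + 2 * g)) (2 + n) eq
...   | refl = contradiction (begin-equality
        2 * 2 ^ (1 + n)              ≡⟨ eq ⟨
        1 * (2 * (1 + 2 * h) + 1)    ≡⟨ solve (h ∷ []) ⟩
        1 + 2 * (1 + 2 * h)          ∎) (even≢odd (2 ^ (1 + n)) (1 + 2 * h))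
d*[2u+d]≡2^[2+n] h d n eq | even p with parity? p | 2p*[2u+2p]≡2^[2+n]⇒p*[u+p]≡2^n (1 + 2 * h) p n eq
... | odd q | eq′ with odd*n≡2^m⇒odd≡1 q (1 + 2 * h + (1 + 2 * q)) n eq′
...   | refl = refl , (begin-equality
        2 + 2 * h                    ≡⟨ solve (h ∷ []) ⟩
        1 * (1 + 2 * h + 1)          ≡⟨ eq′ ⟩
        2 ^ n                        ∎)
d*[2u+d]≡2^[2+n] h d n eq | even p | even q | eq′
  with m+n≡0⇒n≡0 h (odd*n≡2^m⇒odd≡1 (h + q) (2 * q) n (begin-equality
        (1 + 2 * (h + q)) * (2 * q)          ≡⟨ solve (h ∷ q ∷ []) ⟩
        2 * q * (1 + 2 * h + 2 * q)          ≡⟨ eq′ ⟩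
        2 ^ n                                ∎))
... | refl = contradiction eq′ (<⇒≢ (m^n>0 2 n))

u²+4≡5^[1+2t] : ∀ {t u} → u * u + 4 ≡ 5 * (5 ^ t * 5 ^ t) → (t ≡ 0 × u ≡ 1) ⊎ (t ≡ 1 × u ≡ 11)
u²+4≡5^[1+2t] {zero}        {u} eq = inj₁ (refl , m*m≡n*n⇒m≡n u 1 (+-cancelʳ-≡ 4 (u * u) 1 eq))
u²+4≡5^[1+2t] {suc zero}    {u} eq = inj₂ (refl , m*m≡n*n⇒m≡n u 11 (+-cancelʳ-≡ 4 (u * u) 121 eq))
u²+4≡5^[1+2t] {suc (suc t)} {u} eq = contradiction (inj₁ eq) (¬lucas-5^[2+t] {u} t)

2^[3+m]+odd²≢5^[1+2t] : ∀ m h t → 2 ^ (3 + m) + (1 + 2 * h) * (1 + 2 * h) ≢ 5 ^ (1 + 2 * t)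
2^[3+m]+odd²≢5^[1+2t] m h t eq = contradiction (begin-equality
  1                                            ≡⟨ %-cong-+ {2 ^ (3 + m)} {0} {u * u} {1} 8 2^[3+m]%8≡0 ([1+2h]²%8≡1 h) ⟨
  (2 ^ (3 + m) + u * u) % 8                    ≡⟨ cong (_% 8) eq ⟩
  5 ^ (1 + 2 * t) % 8                          ≡⟨ 5^[1+2t]%8≡5 t ⟩
  5                                            ∎) λ ()
  where
  u = 1 + 2 * h
  2^[3+m]%8≡0 : 2 ^ (3 + m) % 8 ≡ 0
  2^[3+m]%8≡0 = trans (cong (_% 8) (2^[3+m]≡2^m*8 m)) (m*n%n≡0 (2 ^ m) 8)

2^[2+x]+u²≡25^t : ∀ {x h t} → 2 ^ (2 + x) + (1 + 2 * h) * (1 + 2 * h) ≡ 5 ^ t * 5 ^ t →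
                  x ≡ 2 × t ≡ 1 × h ≡ 1
2^[2+x]+u²≡25^t {x} {h} {t} eq
  with m*m+k≡n*n⇒n≡m+d (1 + 2 * h) (2 ^ (2 + x)) (5 ^ t) (trans (+-comm _ (2 ^ (2 + x))) eq)
... | d , 5^t≡u+d , d*[2u+d]≡2^[2+x] with d*[2u+d]≡2^[2+n] h d x d*[2u+d]≡2^[2+x]
...   | refl , 2+2h≡2^x with x
...     | zero  = contradiction (suc-injective 2+2h≡2^x) λ ()
...     | suc m with 5^t≡1+2^[1+m] {t} {m} (begin-equality
          5 ^ t                    ≡⟨ 5^t≡u+d ⟩
          1 + 2 * h + 2            ≡⟨ solve (h ∷ []) ⟩
          1 + (2 + 2 * h)          ≡⟨ cong (1 +_) 2+2h≡2^x ⟩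
          1 + 2 ^ (1 + m)          ∎)
...       | refl , refl = refl , refl , *-cancelˡ-≡ h 1 2 (suc-injective (suc-injective 2+2h≡2^x))

2^[2+x]+u²≡5^y : ∀ {x y u} → 2 ^ (2 + x) + u * u ≡ 5 ^ y →
                 (x ≡ 0 × y ≡ 1 × u ≡ 1) ⊎ (x ≡ 0 × y ≡ 3 × u ≡ 11) ⊎ (x ≡ 2 × y ≡ 2 × u ≡ 3)
2^[2+x]+u²≡5^y {x} {y} {u} eq with parity? u | 5^n-odd y
... | even g | k , 5^y≡1+2k = contradiction (begin-equality
      2 * (2 ^ (1 + x) + 2 * (g * g))   ≡⟨ *-distribˡ-+ 2 (2 ^ (1 + x)) (2 * (g * g)) ⟩
      2 ^ (2 + x) + 2 * (2 * (g * g))   ≡⟨ cong (2 ^ (2 + x) +_) (*-assoc 2 2 (g * g)) ⟨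
      2 ^ (2 + x) + 2 * 2 * (g * g)     ≡⟨ cong (2 ^ (2 + x) +_) ([m*n]*[m*n]≡m*m*[n*n] 2 g) ⟨
      2 ^ (2 + x) + 2 * g * (2 * g)     ≡⟨ eq ⟩
      5 ^ y                             ≡⟨ 5^y≡1+2k ⟩
      1 + 2 * k                         ∎) (even≢odd (2 ^ (1 + x) + 2 * (g * g)) k)
... | odd h | _ with parity? y
...   | even t with 2^[2+x]+u²≡25^t {x} {h} {t} (trans eq (m^[2n]≡m^n*m^n 5 t))
...     | refl , refl , refl = inj₂ (inj₂ (refl , refl , refl))
2^[2+x]+u²≡5^y {x} eq | odd h | _ | odd t with x
... | suc m = contradiction eq (2^[3+m]+odd²≢5^[1+2t] m h t)
... | zero with u²+4≡5^[1+2t] {t} {1 + 2 * h}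
                 (trans (+-comm ((1 + 2 * h) * (1 + 2 * h)) 4) (trans eq (cong (5 *_) (m^[2n]≡m^n*m^n 5 t))))
...   | inj₁ (refl , u≡1)  = inj₁ (refl , refl , u≡1)
...   | inj₂ (refl , u≡11) = inj₂ (inj₁ (refl , refl , u≡11))

-- Cancelling powers of 4

4P+[2g]²≡4[P+g²] : ∀ P g → 2 * (2 * P) + 2 * g * (2 * g) ≡ 2 * (2 * (P + g * g))
4P+[2g]²≡4[P+g²] = solve-∀

2^[2+a]*o≡2*[2*[2^a*o]] : ∀ a o → 2 ^ (2 + a) * o ≡ 2 * (2 * (2 ^ a * o))
2^[2+a]*o≡2*[2*[2^a*o]] a o = trans (*-assoc 2 (2 * 2 ^ a) o) (cong (2 *_) (*-assoc 2 (2 ^ a) o))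

1+z²≢2^[2+a]*o : ∀ z a o → 1 + z * z ≢ 2 ^ (2 + a) * o
1+z²≢2^[2+a]*o z a o eq with parity? z
... | even g = contradiction (begin-equality
      2 * (2 ^ (1 + a) * o)            ≡⟨ *-assoc 2 (2 ^ (1 + a)) o ⟨
      2 ^ (2 + a) * o                  ≡⟨ eq ⟨
      1 + 2 * g * (2 * g)              ≡⟨ solve (g ∷ []) ⟩
      1 + 2 * (2 * (g * g))            ∎) (even≢odd (2 ^ (1 + a) * o) (2 * (g * g)))
... | odd g = contradiction (*-cancelˡ-≡ _ _ 2 (begin-equality
      2 * (2 * (2 ^ a * o))            ≡⟨ 2^[2+a]*o≡2*[2*[2^a*o]] a o ⟨
      2 ^ (2 + a) * o                  ≡⟨ eq ⟨
      1 + (1 + 2 * g) * (1 + 2 * g)    ≡⟨ solve (g ∷ []) ⟩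
      2 * (1 + 2 * (g + g * g))        ∎)) (even≢odd (2 ^ a * o) (g + g * g))

2^[2+x]+odd²≢2n : ∀ x g n → 2 ^ (2 + x) + (1 + 2 * g) * (1 + 2 * g) ≢ 2 * n
2^[2+x]+odd²≢2n x g n eq = even≢odd n (2 * 2 ^ x + 2 * (g + g * g)) (begin-equality
  2 * n                                      ≡⟨ eq ⟨
  2 * (2 * 2 ^ x) + (1 + 2 * g) * (1 + 2 * g) ≡⟨ 4P+[1+2g]²≡1+2[2P+2[g+g²]] (2 ^ x) g ⟩
  1 + 2 * (2 * 2 ^ x + 2 * (g + g * g))      ∎)
  where
  4P+[1+2g]²≡1+2[2P+2[g+g²]] : ∀ P g → 2 * (2 * P) + (1 + 2 * g) * (1 + 2 * g) ≡ 1 + 2 * (2 * P + 2 * (g + g * g))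
  4P+[1+2g]²≡1+2[2P+2[g+g²]] = solve-∀

2^[2+x]+z²≢2*odd : ∀ x z r → 2 ^ (2 + x) + z * z ≢ 2 * (1 + 2 * r)
2^[2+x]+z²≢2*odd x z r eq with parity? z
... | odd g  = 2^[2+x]+odd²≢2n x g (1 + 2 * r) eq
... | even g = even≢odd (2 ^ x + g * g) r (*-cancelˡ-≡ _ _ 2 (begin-equality
      2 * (2 * (2 ^ x + g * g))        ≡⟨ 4P+[2g]²≡4[P+g²] (2 ^ x) g ⟨
      2 ^ (2 + x) + 2 * g * (2 * g)    ≡⟨ eq ⟩
      2 * (1 + 2 * r)                  ∎))

-- What remains of 2^x + z² = 2^a · o after cancelling the largest common factor 4^j.
data TwoAdicReduct (x z a o : ℕ) : Set where
  1+u²≡o       : ∀ j u → x ≡ 2 * j → a ≡ 2 * j → z ≡ 2 ^ j * u →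
                 1 + u * u ≡ o → TwoAdicReduct x z a o
  1+u²≡2o      : ∀ j u → x ≡ 2 * j → a ≡ 1 + 2 * j → z ≡ 2 ^ j * u →
                 1 + u * u ≡ 2 * o → TwoAdicReduct x z a o
  2^[2+m]+u²≡o : ∀ j m u → x ≡ 2 * j + (2 + m) → a ≡ 2 * j → z ≡ 2 ^ j * u →
                 2 ^ (2 + m) + u * u ≡ o → TwoAdicReduct x z a o

two-adic-reduct : ∀ x z a {o r} → o ≡ 1 + 2 * r → 5 ∣ o → 2 ^ x + z * z ≡ 2 ^ a * o → TwoAdicReduct x z a o
two-adic-reduct 0 z 0 _ _ eq = 1+u²≡o 0 z refl refl (sym (*-identityˡ z)) (trans eq (*-identityˡ _))
two-adic-reduct 0 z 1 _ _ eq = 1+u²≡2o 0 z refl refl (sym (*-identityˡ z)) eq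
two-adic-reduct 0 z (suc (suc a)) {o} _ _ eq = contradiction eq (1+z²≢2^[2+a]*o z a o)
two-adic-reduct 1 z a _ 5∣o eq = contradiction (subst (5 ∣_) (sym eq) (∣n⇒∣m*n (2 ^ a) 5∣o)) (5∤2+z² z)
two-adic-reduct (suc (suc x)) z 0 _ _ eq =
  2^[2+m]+u²≡o 0 x z refl refl (sym (*-identityˡ z)) (trans eq (*-identityˡ _))
two-adic-reduct (suc (suc x)) z 1 {r = r} o≡1+2r _ eq =
  contradiction (trans eq (cong (2 *_) o≡1+2r)) (2^[2+x]+z²≢2*odd x z r)
two-adic-reduct (suc (suc x)) z (suc (suc a)) {o} {r} o≡1+2r 5∣o eq with parity? z
... | odd g = contradiction (trans eq (2^[2+a]*o≡2*[2*[2^a*o]] a o)) (2^[2+x]+odd²≢2n x g (2 * (2 ^ a * o)))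
... | even h with two-adic-reduct x h a {o} {r} o≡1+2r 5∣o (*-cancelˡ-≡ _ _ 2 (*-cancelˡ-≡ _ _ 2 (begin-equality
      2 * (2 * (2 ^ x + h * h))        ≡⟨ 4P+[2g]²≡4[P+g²] (2 ^ x) h ⟨
      2 ^ (2 + x) + 2 * h * (2 * h)    ≡⟨ eq ⟩
      2 ^ (2 + a) * o                  ≡⟨ 2^[2+a]*o≡2*[2*[2^a*o]] a o ⟩
      2 * (2 * (2 ^ a * o))            ∎)))
...   | 1+u²≡o j u refl refl refl e =
        1+u²≡o (suc j) u (sym (*-suc 2 j)) (sym (*-suc 2 j)) (sym (*-assoc 2 (2 ^ j) u)) e
...   | 1+u²≡2o j u refl refl refl e =
        1+u²≡2o (suc j) u (sym (*-suc 2 j)) (cong suc (sym (*-suc 2 j))) (sym (*-assoc 2 (2 ^ j) u)) e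
...   | 2^[2+m]+u²≡o j m u refl refl refl e =
        2^[2+m]+u²≡o (suc j) m u (cong (_+ (2 + m)) (sym (*-suc 2 j))) (sym (*-suc 2 j)) (sym (*-assoc 2 (2 ^ j) u)) e

-- The families of the statement, with n = m + 1, in the shape produced by two-adic-reduct.
data Solution : ℕ → ℕ → ℕ → ℕ → Set where
  trivial : ∀ {k} → Solution k 0 0 0
  family₁ : ∀ m → Solution m (2 * m + 4) 2 (2 ^ m * 3)
  family₂ : ∀ m → Solution (1 + 2 * m) (2 * m) 1 (2 ^ m * 3)
  family₃ : ∀ m → Solution (2 * m) (2 * m) 1 (2 ^ m * 2)
  family₄ : ∀ m → Solution (2 * m) (2 * m + 2) 1 (2 ^ m * 1)
  family₅ : ∀ m → Solution (2 * m) (2 * (3 * m) + 2) 3 (2 ^ (3 * m) * 11)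

2^x+z²≡1 : ∀ {x z} → 2 ^ x + z * z ≡ 1 → x ≡ 0 × z ≡ 0
2^x+z²≡1 {x} {z} eq with m*m≡n*n⇒m≡n z 0 (n≤0⇒n≡0 (+-cancelˡ-≤ 1 (z * z) 0 (begin
  1 + z * z                    ≤⟨ +-monoˡ-≤ (z * z) (m^n>0 2 x) ⟩
  2 ^ x + z * z                ≡⟨ eq ⟩
  1                            ∎)))
... | refl with m^n≡1⇒n≡0∨m≡1 2 x (trans (sym (+-identityʳ (2 ^ x))) eq)
...   | inj₁ refl = refl , refl

m*n≡1+2j⇒n≡1+2h : ∀ m n j → m * n ≡ 1 + 2 * j → ∃ λ h → n ≡ 1 + 2 * h
m*n≡1+2j⇒n≡1+2h m n j eq with parity? n
... | odd h  = h , refl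
... | even g = contradiction (begin-equality
      2 * (m * g)              ≡⟨ solve (m ∷ g ∷ []) ⟩
      m * (2 * g)              ≡⟨ eq ⟩
      1 + 2 * j                ∎) (even≢odd (m * g) j)

k*3≡2j⇒k≡2i : ∀ {k j} → k * 3 ≡ 2 * j → ∃ λ i → k ≡ 2 * i × j ≡ 3 * i
k*3≡2j⇒k≡2i {k} {j} eq with parity? k
... | even i = i , refl , *-cancelˡ-≡ j (3 * i) 2 (begin-equality
      2 * j                    ≡⟨ eq ⟨
      2 * i * 3                ≡⟨ solve (i ∷ []) ⟩
      2 * (3 * i)              ∎)
... | odd i = contradiction (begin-equality
      2 * j                    ≡⟨ eq ⟨
      (1 + 2 * i) * 3          ≡⟨ solve (i ∷ []) ⟩
      1 + 2 * (1 + 3 * i)      ∎) (even≢odd j (1 + 3 * i))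

solution-from-1+u²≡5^y : ∀ {k j y u} → 1 ≤ y → k * y ≡ 2 * j → 1 + u * u ≡ 5 ^ y →
                         Solution k (2 * j) y (2 ^ j * u)
solution-from-1+u²≡5^y {k} {j} {y} {u} 1≤y k*y≡2j e with 1+u²≡5^y⇒y≡1∧u≡2 {y} {u} 1≤y e
... | refl , refl with trans (sym (*-identityʳ k)) k*y≡2j
...   | refl = family₃ j

solution-from-1+u²≡2*5^y : ∀ {k j y u} → k * y ≡ 1 + 2 * j → 1 + u * u ≡ 2 * 5 ^ y →
                           Solution k (2 * j) y (2 ^ j * u)
solution-from-1+u²≡2*5^y {k} {j} {y} {u} k*y≡1+2j e with m*n≡1+2j⇒n≡1+2h k y j k*y≡1+2j
... | h , refl with 1+u²≡2*5^[1+2h]⇒h≡0∧u≡3 {h} {u} e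
...   | refl , refl with trans (sym (*-identityʳ k)) k*y≡1+2j
...     | refl = family₂ j

solution-from-2^[2+m]+u²≡5^y : ∀ {k j m y u} → k * y ≡ 2 * j → 2 ^ (2 + m) + u * u ≡ 5 ^ y →
                               Solution k (2 * j + (2 + m)) y (2 ^ j * u)
solution-from-2^[2+m]+u²≡5^y {k} {j} {m} {y} {u} k*y≡2j e with 2^[2+x]+u²≡5^y {m} {y} {u} e
... | inj₁ (refl , refl , refl) with trans (sym (*-identityʳ k)) k*y≡2j
...   | refl = family₄ j
solution-from-2^[2+m]+u²≡5^y {k} {j} k*y≡2j e | inj₂ (inj₁ (refl , refl , refl)) with k*3≡2j⇒k≡2i {k} {j} k*y≡2j
... | i , refl , refl = family₅ i
solution-from-2^[2+m]+u²≡5^y {k} {j} k*y≡2j e | inj₂ (inj₂ (refl , refl , refl))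
  with *-cancelˡ-≡ k j 2 (trans (*-comm 2 k) k*y≡2j)
... | refl = family₁ j

equation⇒solution : ∀ {k x y z} → 2 ^ x + z * z ≡ (2 ^ k * 5) ^ y → Solution k x y z
equation⇒solution {k} {x} {zero} {z} eq with 2^x+z²≡1 {x} {z} eq
... | refl , refl = trivial
equation⇒solution {k} {x} {suc y} {z} eq
  with two-adic-reduct x z (k * suc y) {5 ^ suc y} {proj₁ (5^n-odd (suc y))}
         (proj₂ (5^n-odd (suc y))) (m∣m*n (5 ^ y)) (begin-equality
    2 ^ x + z * z                        ≡⟨ eq ⟩
    (2 ^ k * 5) ^ suc y                  ≡⟨ [m*n]^o≡m^o*n^o (2 ^ k) 5 (suc y) ⟩
    (2 ^ k) ^ suc y * 5 ^ suc y          ≡⟨ cong (_* 5 ^ suc y) (^-*-assoc 2 k (suc y)) ⟩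
    2 ^ (k * suc y) * 5 ^ suc y          ∎)
... | 1+u²≡o j u refl k*y≡2j refl e          = solution-from-1+u²≡5^y {k} {j} {suc y} {u} (s≤s z≤n) k*y≡2j e
... | 1+u²≡2o j u refl k*y≡1+2j refl e       = solution-from-1+u²≡2*5^y {k} {j} {suc y} {u} k*y≡1+2j e
... | 2^[2+m]+u²≡o j m u refl k*y≡2j refl e  = solution-from-2^[2+m]+u²≡5^y {k} {j} {m} {suc y} {u} k*y≡2j e

2^[2m+c]≡P*P*2^c : ∀ m c → 2 ^ (2 * m + c) ≡ 2 ^ m * 2 ^ m * 2 ^ c
2^[2m+c]≡P*P*2^c m c = trans (^-distribˡ-+-* 2 (2 * m) c) (cong (_* 2 ^ c) (m^[2n]≡m^n*m^n 2 m))

solution⇒equation : ∀ {k x y z} → Solution k x y z → 2 ^ x + z * z ≡ (2 ^ k * 5) ^ y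
solution⇒equation trivial = refl
solution⇒equation (family₁ m) = begin-equality
  2 ^ (2 * m + 4) + P * 3 * (P * 3)        ≡⟨ cong (_+ P * 3 * (P * 3)) (2^[2m+c]≡P*P*2^c m 4) ⟩
  P * P * 16 + P * 3 * (P * 3)             ≡⟨ identity P ⟩
  P * 5 * (P * 5 * 1)                      ∎
  where
  P = 2 ^ m
  identity : ∀ P → P * P * 16 + P * 3 * (P * 3) ≡ P * 5 * (P * 5 * 1)
  identity = solve-∀
solution⇒equation (family₂ m) = begin-equality
  2 ^ (2 * m) + P * 3 * (P * 3)            ≡⟨ cong (_+ P * 3 * (P * 3)) (m^[2n]≡m^n*m^n 2 m) ⟩
  P * P + P * 3 * (P * 3)                  ≡⟨ identity P ⟩
  2 * (P * P) * 5 * 1                      ≡⟨ cong (λ Q → 2 * Q * 5 * 1) (m^[2n]≡m^n*m^n 2 m) ⟨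
  2 * 2 ^ (2 * m) * 5 * 1                  ∎
  where
  P = 2 ^ m
  identity : ∀ P → P * P + P * 3 * (P * 3) ≡ 2 * (P * P) * 5 * 1
  identity = solve-∀
solution⇒equation (family₃ m) = begin-equality
  2 ^ (2 * m) + P * 2 * (P * 2)            ≡⟨ cong (_+ P * 2 * (P * 2)) (m^[2n]≡m^n*m^n 2 m) ⟩
  P * P + P * 2 * (P * 2)                  ≡⟨ identity P ⟩
  P * P * 5 * 1                            ≡⟨ cong (λ Q → Q * 5 * 1) (m^[2n]≡m^n*m^n 2 m) ⟨
  2 ^ (2 * m) * 5 * 1                      ∎
  where
  P = 2 ^ m
  identity : ∀ P → P * P + P * 2 * (P * 2) ≡ P * P * 5 * 1
  identity = solve-∀
solution⇒equation (family₄ m) = begin-equality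
  2 ^ (2 * m + 2) + P * 1 * (P * 1)        ≡⟨ cong (_+ P * 1 * (P * 1)) (2^[2m+c]≡P*P*2^c m 2) ⟩
  P * P * 4 + P * 1 * (P * 1)              ≡⟨ identity P ⟩
  P * P * 5 * 1                            ≡⟨ cong (λ Q → Q * 5 * 1) (m^[2n]≡m^n*m^n 2 m) ⟨
  2 ^ (2 * m) * 5 * 1                      ∎
  where
  P = 2 ^ m
  identity : ∀ P → P * P * 4 + P * 1 * (P * 1) ≡ P * P * 5 * 1
  identity = solve-∀
solution⇒equation (family₅ m) = begin-equality
  2 ^ (2 * (3 * m) + 2) + R * 11 * (R * 11) ≡⟨ cong (_+ R * 11 * (R * 11)) (2^[2m+c]≡P*P*2^c (3 * m) 2) ⟩
  R * R * 4 + R * 11 * (R * 11)            ≡⟨ cong (λ R → R * R * 4 + R * 11 * (R * 11)) 2^[3m]≡P*[P*P] ⟩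
  Q * Q * 4 + Q * 11 * (Q * 11)            ≡⟨ identity P ⟩
  P * P * 5 * (P * P * 5 * (P * P * 5 * 1)) ≡⟨ cong (λ S → S * 5 * (S * 5 * (S * 5 * 1))) (m^[2n]≡m^n*m^n 2 m) ⟨
  (2 ^ (2 * m) * 5) ^ 3                    ∎
  where
  P = 2 ^ m
  R = 2 ^ (3 * m)
  Q = P * (P * P)
  2^[3m]≡P*[P*P] : R ≡ Q
  2^[3m]≡P*[P*P] = trans (^-distribˡ-+-* 2 m (2 * m)) (cong (P *_) (m^[2n]≡m^n*m^n 2 m))
  identity : ∀ P → P * (P * P) * (P * (P * P)) * 4 + P * (P * P) * 11 * (P * (P * P) * 11) ≡
                   P * P * 5 * (P * P * 5 * (P * P * 5 * 1))
  identity = solve-∀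

2m+4≡2[1+m]+2 : ∀ m → 2 * m + 4 ≡ 2 * suc m + 2
2m+4≡2[1+m]+2 = solve-∀

2m+2≡2[1+m] : ∀ m → 2 * m + 2 ≡ 2 * suc m
2m+2≡2[1+m] = solve-∀

1+2m≡2[1+m]∸1 : ∀ m → 1 + 2 * m ≡ 2 * suc m ∸ 1
1+2m≡2[1+m]∸1 m = cong (_∸ 1) (sym (*-suc 2 m))

2m≡2[1+m]∸2 : ∀ m → 2 * m ≡ 2 * suc m ∸ 2
2m≡2[1+m]∸2 m = cong (_∸ 2) (sym (*-suc 2 m))

2[3m]+2≡6[1+m]∸4 : ∀ m → 2 * (3 * m) + 2 ≡ 6 * suc m ∸ 4
2[3m]+2≡6[1+m]∸4 m = begin-equality
  2 * (3 * m) + 2          ≡⟨ solve (m ∷ []) ⟩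
  2 + 6 * m                ≡⟨ cong (_∸ 4) (*-suc 6 m) ⟨
  6 * suc m ∸ 4            ∎

2^[3m]*11≡11*8^m : ∀ m → 2 ^ (3 * m) * 11 ≡ 11 * 8 ^ m
2^[3m]*11≡11*8^m m = trans (*-comm (2 ^ (3 * m)) 11) (cong (11 *_) (sym (^-*-assoc 2 3 m)))

listed⇔solution : ∀ {k x y z} → Listed k x y z ⇔ Solution k x y z
listed⇔solution = mk⇔ to from
  where
  cast : ∀ {k k′ x x′ y z z′} → k ≡ k′ → x ≡ x′ → z ≡ z′ → Solution k x y z → Solution k′ x′ y z′
  cast refl refl refl s = s
  to : ∀ {k x y z} → Listed k x y z → Solution k x y z
  to (inj₁ (refl , refl , refl)) = trivial
  to (inj₂ (suc m , _ , inj₁ (refl , refl , refl , refl))) =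
    cast refl (2m+4≡2[1+m]+2 m) (*-comm (2 ^ m) 3) (family₁ m)
  to (inj₂ (suc m , _ , inj₂ (inj₁ (refl , refl , refl , refl)))) =
    cast (1+2m≡2[1+m]∸1 m) (2m≡2[1+m]∸2 m) (*-comm (2 ^ m) 3) (family₂ m)
  to (inj₂ (suc m , _ , inj₂ (inj₂ (inj₁ (refl , refl , refl , refl))))) =
    cast (2m≡2[1+m]∸2 m) (2m≡2[1+m]∸2 m) (*-comm (2 ^ m) 2) (family₃ m)
  to (inj₂ (suc m , _ , inj₂ (inj₂ (inj₂ (inj₁ (refl , refl , refl , refl)))))) =
    cast (2m≡2[1+m]∸2 m) (2m+2≡2[1+m] m) (*-identityʳ (2 ^ m)) (family₄ m)
  to (inj₂ (suc m , _ , inj₂ (inj₂ (inj₂ (inj₂ (refl , refl , refl , refl)))))) =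
    cast (2m≡2[1+m]∸2 m) (2[3m]+2≡6[1+m]∸4 m) (2^[3m]*11≡11*8^m m) (family₅ m)
  from : ∀ {k x y z} → Solution k x y z → Listed k x y z
  from trivial     = inj₁ (refl , refl , refl)
  from (family₁ m) = inj₂ (suc m , s≤s z≤n , inj₁ (refl , 2m+4≡2[1+m]+2 m , refl , *-comm (2 ^ m) 3))
  from (family₂ m) = inj₂ (suc m , s≤s z≤n , inj₂ (inj₁
    (1+2m≡2[1+m]∸1 m , 2m≡2[1+m]∸2 m , refl , *-comm (2 ^ m) 3)))
  from (family₃ m) = inj₂ (suc m , s≤s z≤n , inj₂ (inj₂ (inj₁
    (2m≡2[1+m]∸2 m , 2m≡2[1+m]∸2 m , refl , *-comm (2 ^ m) 2))))
  from (family₄ m) = inj₂ (suc m , s≤s z≤n , inj₂ (inj₂ (inj₂ (inj₁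
    (2m≡2[1+m]∸2 m , 2m+2≡2[1+m] m , refl , *-identityʳ (2 ^ m))))))
  from (family₅ m) = inj₂ (suc m , s≤s z≤n , inj₂ (inj₂ (inj₂ (inj₂
    (2m≡2[1+m]∸2 m , 2[3m]+2≡6[1+m]∸4 m , refl , 2^[3m]*11≡11*8^m m)))))

-[+a]+[+b]≡+c⇔a+c≡b : ∀ a b c → ℤ.- (ℤ.+ a) ℤ.+ ℤ.+ b ≡ ℤ.+ c ⇔ a + c ≡ b
-[+a]+[+b]≡+c⇔a+c≡b a b c = mk⇔
  (λ eq → ℤ.+-injective (trans (ℤ.pos-+ a c)
                                (trans (cong (λ i → ℤ.+ a ℤ.+ i) (sym eq)) (i+[-i+j]≡j (ℤ.+ a) (ℤ.+ b)))))
  (λ eq → trans (cong (λ n → ℤ.- (ℤ.+ a) ℤ.+ ℤ.+ n) (sym eq))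
                (trans (cong (λ i → ℤ.- (ℤ.+ a) ℤ.+ i) (ℤ.pos-+ a c)) (-i+[i+j]≡j (ℤ.+ a) (ℤ.+ c))))
  where
  i+[-i+j]≡j : ∀ i j → i ℤ.+ (ℤ.- i ℤ.+ j) ≡ j
  i+[-i+j]≡j i j = trans (sym (ℤ.+-assoc i (ℤ.- i) j)) (trans (cong (ℤ._+ j) (ℤ.+-inverseʳ i)) (ℤ.+-identityˡ j))
  -i+[i+j]≡j : ∀ i j → ℤ.- i ℤ.+ (i ℤ.+ j) ≡ j
  -i+[i+j]≡j i j = trans (sym (ℤ.+-assoc (ℤ.- i) i j)) (trans (cong (ℤ._+ j) (ℤ.+-inverseˡ i)) (ℤ.+-identityˡ j))

equation⇔natural : ∀ k x y z → Equation k x y z ⇔ 2 ^ x + z * z ≡ (2 ^ k * 5) ^ y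
equation⇔natural k x y z = subst (λ s → Equation k x y z ⇔ 2 ^ x + s ≡ (2 ^ k * 5) ^ y)
  (cong (z *_) (*-identityʳ z)) (-[+a]+[+b]≡+c⇔a+c≡b (2 ^ x) ((2 ^ k * 5) ^ y) (z ^ 2))

theorem3p5 : (k x y z : ℕ) → Equation k x y z ⇔ Listed k x y z
theorem3p5 k x y z =
  ⇔-trans (equation⇔natural k x y z) (⇔-trans (mk⇔ equation⇒solution solution⇒equation) (⇔-sym listed⇔solution))
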